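{- Let $m,n\ge 2$ and let $C$ be any maximal configuration on the $m\times n$ grid. Then $$\frac{1}{2}mn\le|C|\le \frac{3}{4}mn+\frac{m-1}{2}+\frac{n}{4}.$$
   Context: The $m\times n$ grid is $[m]\times[n]=\{(i,j):1\le i\le m,\ 1\le j\le n\}$; $(i,j)$ is the lot in row $i$ and column $j$, rows counted from the north (row $1$ is northernmost, row $m$ southernmost) and columns from the west (column $1$ westernmost). A configuration is a subset $C\subseteq[m]\times[n]$ (the occupied lots, i.e. lots with a house); $|C|$ is its cardinality (occupancy). A house at $(i,j)\in C$ is blocked from sunlight if its eastern, western and southern neighbors $(i,j+1)$, $(i,j-1)$, $(i+1,j)$ all lie in the grid and are all occupied (lots outside the grid never obstruct sunlight, so houses on the eastern, western or southern border are never blocked). A configuration is permissible if no house in it is blocked; it is maximal if it is permissible and no permissible configuration strictly contains it. -}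

module Defs where

open import Data.Nat using (ℕ; suc)
open import Data.Fin using (Fin; toℕ)
open import Data.Bool using (Bool; true; false; if_then_else_)
open import Data.List using (map; allFin)
open import Data.Nat.ListAction using (sum)
open import Data.Product using (Σ; _×_; ∃₂)
open import Relation.Binary.PropositionalEquality using (_≡_)
open import Relation.Nullary using (¬_)

-- A configuration on the m × n grid: C i j ≡ true means lot (i,j) is occupied.
-- Indices are 0-based: i = 0 is the northernmost row, j = 0 the westernmost column.
Config : ℕ → ℕ → Set
Config m n = Fin m → Fin n → Bool

card : ∀ {m n} → Config m n → ℕ
card {m} {n} C = sum (map (λ i → sum (map (λ j → if C i j then 1 else 0) (allFin n))) (allFin m))

Blocked : ∀ {m n} → Config m n → Fin m → Fin n → Set
Blocked {m} {n} C i j =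
  C i j ≡ true
  × Σ (Fin n) (λ e → toℕ e ≡ suc (toℕ j) × C i e ≡ true)
  × Σ (Fin n) (λ w → suc (toℕ w) ≡ toℕ j × C i w ≡ true)
  × Σ (Fin m) (λ s → toℕ s ≡ suc (toℕ i) × C s j ≡ true)

Permissible : ∀ {m n} → Config m n → Set
Permissible C = ∀ i j → ¬ Blocked C i j

_⊆_ : ∀ {m n} → Config m n → Config m n → Set
C ⊆ D = ∀ i j → C i j ≡ true → D i j ≡ true

_⊂_ : ∀ {m n} → Config m n → Config m n → Set
C ⊂ D = C ⊆ D × ∃₂ (λ i j → D i j ≡ true × C i j ≡ false)

Maximal : ∀ {m n} → Config m n → Set
Maximal {m} {n} C = Permissible C × (∀ (D : Config m n) → Permissible D → ¬ (C ⊂ D))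

-- Upper bound: take two adjacent rows, a on top of b. A column contributes
-- 3 a + b ≤ 3 unless both its lots are occupied; then the house in a is not
-- blocked, so it has a vacant horizontal neighbour in a, and a vacant lot of a
-- contributes only b ≤ 1. Charging each excess to such a vacancy (each vacancy
-- absorbs two, the ends of the row absorb one each) gives 3 |a| + |b| ≤ 3 n + 2,
-- and summing over the m - 1 pairs of adjacent rows bounds 4 |C|.
--
-- Lower bound: by maximality, a house added on a vacant lot would be blocked
-- itself or would block its western, eastern or northern neighbour. Charge the
-- vacancy to the house west of it in the first two cases (that house ends a
-- horizontal run), east of it in the third (the western end of a run of length
-- at least 2), north of it in the last (an interior house of a run). Every
-- house is charged at most once, so there are at most as many vacant lots as
-- houses.
{-# OPTIONS --safe #-}
module Submission where

open import Defs
open import Data.Bool using (Bool; true; false; T; not; _∧_; _∨_; if_then_else_)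
open import Data.Bool.Properties using (T-∧; T-∨; T-≡; T-not-≡)
open import Data.Empty using (⊥-elim)
open import Data.Fin using (Fin; toℕ; fromℕ<) renaming (zero to fzero; suc to fsuc)
open import Data.Fin.Properties using (toℕ-fromℕ<)
open import Data.List using (map; allFin; tabulate)
open import Data.List.Properties using (map-tabulate)
open import Data.Nat using (ℕ; zero; suc; _+_; _*_; _∸_; _≤_; _<_; z≤n; s≤s; _≡ᵇ_)
open import Data.Nat.ListAction using (sum)
open import Data.Nat.Properties
open import Algebra.Properties.CommutativeSemigroup +-commutativeSemigroup
  using (interchange; xy∙z≈xz∙y)
open import Data.Nat.Tactic.RingSolver using (solve-∀)
open import Data.Product using (Σ; _×_; _,_)
open import Data.Sum using (_⊎_; inj₁; inj₂)
open import Function using (_∘_; id; Equivalence)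
open import Relation.Binary.PropositionalEquality
open import Relation.Nullary using (¬_)
open import Relation.Nullary.Decidable using (T?; _⊎-dec_; decidable-stable)

open Equivalence using (to; from)

∑ : ℕ → (ℕ → ℕ) → ℕ
∑ zero    f = 0
∑ (suc n) f = ∑ n f + f n

syntax ∑ n (λ k → e) = ∑[ k < n ] e

∑-cong : ∀ n {f g : ℕ → ℕ} → (∀ {k} → k < n → f k ≡ g k) → ∑ n f ≡ ∑ n g
∑-cong zero    eq = refl
∑-cong (suc n) eq = cong₂ _+_ (∑-cong n (eq ∘ m<n⇒m<1+n)) (eq (n<1+n n))

∑-mono-≤ : ∀ n {f g : ℕ → ℕ} → (∀ {k} → k < n → f k ≤ g k) → ∑ n f ≤ ∑ n g
∑-mono-≤ zero    le = z≤n
∑-mono-≤ (suc n) le = +-mono-≤ (∑-mono-≤ n (le ∘ m<n⇒m<1+n)) (le (n<1+n n))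

∑-distrib-+ : ∀ n (f g : ℕ → ℕ) → ∑[ k < n ] (f k + g k) ≡ ∑ n f + ∑ n g
∑-distrib-+ zero    f g = refl
∑-distrib-+ (suc n) f g =
  trans (cong (_+ (f n + g n)) (∑-distrib-+ n f g)) (interchange (∑ n f) (∑ n g) (f n) (g n))

∑-distrib-+³ : ∀ n (f g h : ℕ → ℕ) →
  ∑[ k < n ] (f k + g k + h k) ≡ ∑ n f + ∑ n g + ∑ n h
∑-distrib-+³ n f g h = trans (∑-distrib-+ n _ h) (cong (_+ ∑ n h) (∑-distrib-+ n f g))

∑-distribˡ-* : ∀ n c (f : ℕ → ℕ) → ∑[ k < n ] (c * f k) ≡ c * ∑ n f
∑-distribˡ-* zero    c f = sym (*-zeroʳ c)
∑-distribˡ-* (suc n) c f =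
  trans (cong (_+ c * f n) (∑-distribˡ-* n c f)) (sym (*-distribˡ-+ c (∑ n f) (f n)))

∑-const : ∀ n c → ∑[ k < n ] c ≡ n * c
∑-const zero    c = refl
∑-const (suc n) c = trans (cong (_+ c) (∑-const n c)) (+-comm (n * c) c)

∑-shift : ∀ n (f : ℕ → ℕ) → ∑ n (f ∘ suc) + f 0 ≡ ∑ n f + f n
∑-shift zero    f = refl
∑-shift (suc n) f =
  trans (xy∙z≈xz∙y (∑ n (f ∘ suc)) (f (suc n)) (f 0)) (cong (_+ f (suc n)) (∑-shift n f))

∑-≤-∑∘suc : ∀ n (f : ℕ → ℕ) → ∑ n f ≤ ∑ n (f ∘ suc) + f 0
∑-≤-∑∘suc n f = ≤-trans (m≤m+n (∑ n f) (f n)) (≤-reflexive (sym (∑-shift n f)))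

∑∘suc-≤-∑ : ∀ n (f : ℕ → ℕ) → ∑ n (f ∘ suc) ≤ ∑ n f + f n
∑∘suc-≤-∑ n f = ≤-trans (m≤m+n (∑ n (f ∘ suc)) (f 0)) (≤-reflexive (∑-shift n f))

⟦_⟧ : Bool → ℕ
⟦ b ⟧ = if b then 1 else 0

⟦⟧≤1 : ∀ b → ⟦ b ⟧ ≤ 1
⟦⟧≤1 false = z≤n
⟦⟧≤1 true  = ≤-refl

⟦not⟧+⟦⟧≡1 : ∀ b → ⟦ not b ⟧ + ⟦ b ⟧ ≡ 1
⟦not⟧+⟦⟧≡1 false = refl
⟦not⟧+⟦⟧≡1 true  = refl

⟦∧⟧≤⟦⟧ˡ : ∀ a b → ⟦ a ∧ b ⟧ ≤ ⟦ a ⟧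
⟦∧⟧≤⟦⟧ˡ false b = z≤n
⟦∧⟧≤⟦⟧ˡ true  b = ⟦⟧≤1 b

⟦∧⟧≤⟦⟧ʳ : ∀ a b → ⟦ a ∧ b ⟧ ≤ ⟦ b ⟧
⟦∧⟧≤⟦⟧ʳ false b = z≤n
⟦∧⟧≤⟦⟧ʳ true  b = ≤-refl

T-∧³ : ∀ {a b c} → T a → T b → T c → T (a ∧ b ∧ c)
T-∧³ ta tb tc = from T-∧ (ta , from T-∧ (tb , tc))

extend : ∀ {n} {A : Set} → A → (Fin n → A) → ℕ → A
extend {zero}  d f k       = d
extend {suc n} d f zero    = f fzero
extend {suc n} d f (suc k) = extend d (f ∘ fsuc) k

extend-toℕ : ∀ {n} {A : Set} (d : A) (f : Fin n → A) x → extend d f (toℕ x) ≡ f x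
extend-toℕ d f fzero    = refl
extend-toℕ d f (fsuc x) = extend-toℕ d (f ∘ fsuc) x

extend-≥ : ∀ {n} {A : Set} (d : A) (f : Fin n → A) {k} → n ≤ k → extend d f k ≡ d
extend-≥ {zero}  d f _         = refl
extend-≥ {suc n} d f (s≤s n≤k) = extend-≥ d (f ∘ fsuc) n≤k

extend-true : ∀ {n} (f : Fin n → Bool) {k} → T (extend false f k) →
  Σ (Fin n) λ x → toℕ x ≡ k × T (f x)
extend-true {suc n} f {zero}  t = fzero , refl , t
extend-true {suc n} f {suc k} t with extend-true (f ∘ fsuc) t
... | x , refl , fx = fsuc x , refl , fx

sum-map-allFin : ∀ {n} (h : Fin n → ℕ) → sum (map h (allFin n)) ≡ ∑ n (extend 0 h)
sum-map-allFin h = trans (cong sum (map-tabulate id h)) (sum-tabulate h)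
  where
  sum-tabulate : ∀ {n} (h : Fin n → ℕ) → sum (tabulate h) ≡ ∑ n (extend 0 h)
  sum-tabulate {zero}  h = refl
  sum-tabulate {suc n} h = begin
    h fzero + sum (tabulate (h ∘ fsuc))  ≡⟨ cong (h fzero +_) (sum-tabulate (h ∘ fsuc)) ⟩
    h fzero + ∑ n (extend 0 (h ∘ fsuc))  ≡⟨ +-comm (h fzero) _ ⟩
    ∑ n (extend 0 h ∘ suc) + h fzero     ≡⟨ ∑-shift n (extend 0 h) ⟩
    ∑ (suc n) (extend 0 h)               ∎
    where open ≡-Reasoning

∀Fin⇒∀< : ∀ {n} {P : ℕ → Set} → (∀ (x : Fin n) → P (toℕ x)) → ∀ {k} → k < n → P k
∀Fin⇒∀< {P = P} h k<n = subst P (toℕ-fromℕ< k<n) (h (fromℕ< k<n))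

-- Grids: configurations indexed by ℕ, with every lot outside the rectangle vacant.

Grid : Set
Grid = ℕ → ℕ → Bool

occupied : ∀ {m n} → Config m n → Grid
occupied C i j = extend false (λ y → extend false (λ x → C x y) i) j

restrict : ∀ {m n} → Grid → Config m n
restrict g x y = g (toℕ x) (toℕ y)

occupied-toℕ : ∀ {m n} (C : Config m n) x y → occupied C (toℕ x) (toℕ y) ≡ C x y
occupied-toℕ C x y = trans (extend-toℕ false _ y) (extend-toℕ false (λ x′ → C x′ y) x)

occupied-≥ : ∀ {m n} (C : Config m n) i {j} → n ≤ j → occupied C i j ≡ false
occupied-≥ C i = extend-≥ false _

occupied-true : ∀ {m n} (C : Config m n) {i j} → T (occupied C i j) →
  Σ (Fin m) λ x → Σ (Fin n) λ y → toℕ x ≡ i × toℕ y ≡ j × T (C x y)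
occupied-true C {i} {j} t =
  let (y , y≡j , t′) = extend-true _ {j} t
      (x , x≡i , Cxy) = extend-true _ {i} t′
  in x , y , x≡i , y≡j , Cxy

occupied-in-row : ∀ {m n} (C : Config m n) x {j} → T (occupied C (toℕ x) j) →
  Σ (Fin n) λ y → toℕ y ≡ j × C x y ≡ true
occupied-in-row C x {j} t =
  let (y , y≡j , t′) = extend-true _ {j} t
  in y , y≡j , to T-≡ (subst T (extend-toℕ false (λ x′ → C x′ y) x) t′)

occupied-in-column : ∀ {m n} (C : Config m n) {i} y → T (occupied C i (toℕ y)) →
  Σ (Fin m) λ x → toℕ x ≡ i × C x y ≡ true
occupied-in-column C {i} y t =
  let (x , x≡i , Cxy) = extend-true _ {i} (subst T (extend-toℕ false _ y) t)
  in x , x≡i , to T-≡ Cxy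

houses vacancies : ℕ → Grid → ℕ → ℕ
houses    n g i = ∑[ j < n ] ⟦ g i j ⟧
vacancies n g i = ∑[ j < n ] ⟦ not (g i j) ⟧

card-occupied : ∀ {m n} (C : Config m n) → card C ≡ ∑ m (houses n (occupied C))
card-occupied {m} {n} C = trans (sum-map-allFin row) (∑-cong m (∀Fin⇒∀< {P = row-houses-at} row-houses))
  where
  open ≡-Reasoning
  row : Fin m → ℕ
  row x = sum (map (λ y → ⟦ C x y ⟧) (allFin n))
  row-houses-at : ℕ → Set
  row-houses-at i = extend 0 row i ≡ houses n (occupied C) i
  row-houses : ∀ x → extend 0 row (toℕ x) ≡ houses n (occupied C) (toℕ x)
  row-houses x = begin
    extend 0 row (toℕ x)                          ≡⟨ extend-toℕ 0 row x ⟩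
    row x                                         ≡⟨ sum-map-allFin (λ y → ⟦ C x y ⟧) ⟩
    ∑ n (extend 0 (λ y → ⟦ C x y ⟧))              ≡⟨ ∑-cong n (∀Fin⇒∀< {P = column-house} λ y →
                                                       trans (extend-toℕ 0 _ y) (cong ⟦_⟧ (sym (occupied-toℕ C x y)))) ⟩
    houses n (occupied C) (toℕ x)                 ∎
    where
    column-house : ℕ → Set
    column-house j = extend 0 (λ y → ⟦ C x y ⟧) j ≡ ⟦ occupied C (toℕ x) j ⟧

houses≤n : ∀ n g i → houses n g i ≤ n
houses≤n n g i =
  ≤-trans (∑-mono-≤ n (λ {j} _ → ⟦⟧≤1 (g i j))) (≤-reflexive (trans (∑-const n 1) (*-identityʳ n)))

∑vacancies+∑houses : ∀ m n g → ∑ m (vacancies n g) + ∑ m (houses n g) ≡ m * n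
∑vacancies+∑houses m n g = begin
  ∑ m (vacancies n g) + ∑ m (houses n g)          ≡⟨ ∑-distrib-+ m _ _ ⟨
  ∑[ i < m ] (vacancies n g i + houses n g i)     ≡⟨ ∑-cong m (λ {i} _ → row i) ⟩
  ∑[ i < m ] n                                    ≡⟨ ∑-const m n ⟩
  m * n                                           ∎
  where
  open ≡-Reasoning
  row : ∀ i → vacancies n g i + houses n g i ≡ n
  row i = begin
    vacancies n g i + houses n g i                ≡⟨ ∑-distrib-+ n _ _ ⟨
    ∑[ j < n ] (⟦ not (g i j) ⟧ + ⟦ g i j ⟧)      ≡⟨ ∑-cong n (λ {j} _ → ⟦not⟧+⟦⟧≡1 (g i j)) ⟩
    ∑[ j < n ] 1                                  ≡⟨ ∑-const n 1 ⟩
    n * 1                                         ≡⟨ *-identityʳ n ⟩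
    n                                             ∎

west : (ℕ → Bool) → ℕ → Bool
west a zero    = false
west a (suc j) = a j

Blockedℕ : Grid → ℕ → ℕ → Set
Blockedℕ g i j = T (west (g i) j) × T (g i j) × T (g i (suc j)) × T (g (suc i) j)

permissible-occupied : ∀ {m n} {C : Config m n} → Permissible C →
  ∀ i j → ¬ Blockedℕ (occupied C) i j
permissible-occupied {C = C} P i j (w , c , e , s) with occupied-true C c
... | x , fzero  , refl , refl , _   = w
... | x , fsuc y , refl , refl , Cxy =
  let (w′ , w′≡y , Cxw′) = occupied-in-row C x w
  in P x (fsuc y) ( to T-≡ Cxy , occupied-in-row C x e , (w′ , cong suc w′≡y , Cxw′)
                  , occupied-in-column C (fsuc y) s)

blocked-restrict : ∀ {m n} (g : Grid) {x : Fin m} {y : Fin n} →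
  Blocked (restrict g) x y → Blockedℕ g (toℕ x) (toℕ y)
blocked-restrict g {x} {y} (c , (e , e≡y+1 , ce) , (w , w+1≡y , cw) , (s , s≡x+1 , cs)) =
    subst (T ∘ west (g (toℕ x))) w+1≡y (from T-≡ cw)
  , from T-≡ c
  , subst (T ∘ g (toℕ x)) e≡y+1 (from T-≡ ce)
  , subst (λ k → T (g k (toℕ y))) s≡x+1 (from T-≡ cs)

-- The upper bound

adjacent-rows : ∀ n (g : Grid) i → g i n ≡ false → (∀ j → ¬ Blockedℕ g i j) →
  3 * houses n g i + houses n g (suc i) ≤ 3 * n + 2
adjacent-rows n g i east-border unblocked = +-cancelʳ-≤ (2 * V) _ _ (begin
  3 * A + B + 2 * V
    ≡⟨ cong₂ _+_ (cong (_+ B) (∑-distribˡ-* n 3 _)) (∑-distribˡ-* n 2 _) ⟨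
  ∑[ j < n ] (3 * ⟦ a j ⟧) + B + ∑[ j < n ] (2 * ⟦ not (a j) ⟧)
    ≡⟨ ∑-distrib-+³ n _ _ _ ⟨
  ∑[ j < n ] (3 * ⟦ a j ⟧ + ⟦ b j ⟧ + 2 * ⟦ not (a j) ⟧)
    ≤⟨ ∑-mono-≤ n (λ {j} _ → column-bound (west a j) (a j) (a (suc j)) (b j) (unblocked j)) ⟩
  ∑[ j < n ] (3 + ⟦ not (west a j) ⟧ + ⟦ not (a (suc j)) ⟧)
    ≡⟨ ∑-distrib-+³ n _ _ _ ⟩
  ∑[ j < n ] 3 + ∑[ j < n ] ⟦ not (west a j) ⟧ + ∑[ j < n ] ⟦ not (a (suc j)) ⟧
    ≤⟨ +-mono-≤ (+-mono-≤ (≤-reflexive (∑-const n 3)) west-vacancies) east-vacancies ⟩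
  n * 3 + (V + 1) + (V + 1)
    ≡⟨ rearrange n V ⟩
  3 * n + 2 + 2 * V ∎)
  where
  open ≤-Reasoning
  a b : ℕ → Bool
  a = g i
  b = g (suc i)
  A B V : ℕ
  A = houses n g i
  B = houses n g (suc i)
  V = vacancies n g i

  -- The top house of a column occupied in both rows is not blocked, so a horizontal neighbour is vacant.
  column-bound : ∀ w x e y → ¬ (T w × T x × T e × T y) →
    3 * ⟦ x ⟧ + ⟦ y ⟧ + 2 * ⟦ not x ⟧ ≤ 3 + ⟦ not w ⟧ + ⟦ not e ⟧
  column-bound w     false e     false _ = s≤s (s≤s z≤n)
  column-bound w     false e     true  _ = s≤s (s≤s (s≤s z≤n))
  column-bound w     true  e     false _ = s≤s (s≤s (s≤s z≤n))
  column-bound false true  e     true  _ = m≤m+n 4 ⟦ not e ⟧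
  column-bound true  true  false true  _ = ≤-refl
  column-bound true  true  true  true  blocked = ⊥-elim (blocked _)

  west-vacancies : ∑[ j < n ] ⟦ not (west a j) ⟧ ≤ V + 1
  west-vacancies = ∑-≤-∑∘suc n (λ j → ⟦ not (west a j) ⟧)

  east-vacancies : ∑[ j < n ] ⟦ not (a (suc j)) ⟧ ≤ V + 1
  east-vacancies = subst (λ x → ∑[ j < n ] ⟦ not (a (suc j)) ⟧ ≤ V + ⟦ not x ⟧) east-border (∑∘suc-≤-∑ n (λ j → ⟦ not (a j) ⟧))

  rearrange : ∀ n V → n * 3 + (V + 1) + (V + 1) ≡ 3 * n + 2 + 2 * V
  rearrange = solve-∀

4*∑-≤ : ∀ m′ {n B} (r : ℕ → ℕ) → (∀ i → r i ≤ n) → (∀ i → 3 * r i + r (suc i) ≤ B) →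
  4 * ∑ (suc m′) r ≤ m′ * B + 4 * n
4*∑-≤ m′ {n} {B} r r≤n adjacent = begin
  4 * ∑ (suc m′) r                                      ≡⟨ split (∑ (suc m′) r) ⟩
  3 * (∑ m′ r + r m′) + (∑ m′ r + r m′)                 ≡⟨ cong (3 * (∑ m′ r + r m′) +_) (∑-shift m′ r) ⟨
  3 * (∑ m′ r + r m′) + (∑ m′ (r ∘ suc) + r 0)          ≡⟨ regroup (∑ m′ r) (r m′) (∑ m′ (r ∘ suc)) (r 0) ⟩
  (3 * ∑ m′ r + ∑ m′ (r ∘ suc)) + (3 * r m′ + r 0)      ≡⟨ cong (_+ (3 * r m′ + r 0)) pairs ⟨
  ∑[ i < m′ ] (3 * r i + r (suc i)) + (3 * r m′ + r 0)  ≤⟨ +-mono-≤ (∑-mono-≤ m′ (λ _ → adjacent _)) ends ⟩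
  ∑[ i < m′ ] B + (3 * n + n)                           ≡⟨ cong₂ _+_ (∑-const m′ B) (sym (split n)) ⟩
  m′ * B + 4 * n                                        ∎
  where
  open ≤-Reasoning
  split : ∀ x → 4 * x ≡ 3 * x + x
  split = solve-∀
  regroup : ∀ s t s′ t′ → 3 * (s + t) + (s′ + t′) ≡ (3 * s + s′) + (3 * t + t′)
  regroup = solve-∀
  pairs : ∑[ i < m′ ] (3 * r i + r (suc i)) ≡ 3 * ∑ m′ r + ∑ m′ (r ∘ suc)
  pairs = trans (∑-distrib-+ m′ _ _) (cong (_+ ∑ m′ (r ∘ suc)) (∑-distribˡ-* m′ 3 r))
  ends : 3 * r m′ + r 0 ≤ 3 * n + n
  ends = +-mono-≤ (*-monoʳ-≤ 3 (r≤n m′)) (r≤n 0)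

-- Maximality and the lower bound

runEnd runStart runInterior : Grid → ℕ → ℕ → Bool
runEnd      g i j = g i j ∧ not (g i (suc j))
runStart    g i j = g i j ∧ not (west (g i) j) ∧ g i (suc j)
runInterior g i j = g i j ∧ west (g i) j ∧ g i (suc j)

-- A house inserted at (i , j) would block itself, or its western, eastern or
-- northern neighbour.

selfBlocking westBlocking eastBlocking northBlocking : Grid → ℕ → ℕ → Bool
selfBlocking  g i       j       = west (g i) j ∧ g i (suc j) ∧ g (suc i) j
westBlocking  g i       zero    = false
westBlocking  g i       (suc j) = g i j ∧ west (g i) j ∧ g (suc i) j
eastBlocking  g i       j       = g i (suc j) ∧ g i (suc (suc j)) ∧ g (suc i) (suc j)
northBlocking g zero    j       = false
northBlocking g (suc i) j       = runInterior g i j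

InsertionBlocks : Grid → ℕ → ℕ → Set
InsertionBlocks g i j =
  T (selfBlocking g i j) ⊎ T (westBlocking g i j) ⊎ T (eastBlocking g i j) ⊎ T (northBlocking g i j)

insertℕ : ℕ → ℕ → Grid → Grid
insertℕ i j g k l = g k l ∨ ((k ≡ᵇ i) ∧ (l ≡ᵇ j))

OccupiedOrInserted : Grid → ℕ → ℕ → ℕ → ℕ → Set
OccupiedOrInserted g i j k l = T (g k l) ⊎ (k , l) ≡ (i , j)

insertℕ-true : ∀ (g : Grid) {i j k l} → T (insertℕ i j g k l) → OccupiedOrInserted g i j k l
insertℕ-true g {k = k} {l} t with to T-∨ t
... | inj₁ gkl = inj₁ gkl
... | inj₂ t′  = let (k≡i , l≡j) = to T-∧ t′ in inj₂ (cong₂ _,_ (≡ᵇ⇒≡ k _ k≡i) (≡ᵇ⇒≡ l _ l≡j))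

occupied-before : ∀ (g : Grid) {i j k l} → OccupiedOrInserted g i j k l → (k , l) ≢ (i , j) → T (g k l)
occupied-before g (inj₁ t)  _  = t
occupied-before g (inj₂ eq) ne = ⊥-elim (ne eq)

insertion-blocks : ∀ (g : Grid) {i j k l} → (∀ k l → ¬ Blockedℕ g k l) →
  OccupiedOrInserted g i j k l →
  OccupiedOrInserted g i j k (suc l) →
  OccupiedOrInserted g i j k (suc (suc l)) →
  OccupiedOrInserted g i j (suc k) (suc l) →
  InsertionBlocks g i j
insertion-blocks g unblocked w (inj₂ refl) e s =
  inj₁ (T-∧³ (occupied-before g w λ ()) (occupied-before g e λ ()) (occupied-before g s λ ()))
insertion-blocks g unblocked (inj₂ refl) (inj₁ c) e s =
  inj₂ (inj₂ (inj₁ (T-∧³ c (occupied-before g e λ ()) (occupied-before g s λ ()))))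
insertion-blocks g unblocked (inj₁ w) (inj₁ c) (inj₂ refl) s = inj₂ (inj₁ (T-∧³ c w (occupied-before g s λ ())))
insertion-blocks g unblocked (inj₁ w) (inj₁ c) (inj₁ e) (inj₂ refl) = inj₂ (inj₂ (inj₂ (T-∧³ c w e)))
insertion-blocks g unblocked (inj₁ w) (inj₁ c) (inj₁ e) (inj₁ s) = ⊥-elim (unblocked _ _ (w , c , e , s))

blocked-insertℕ : ∀ (g : Grid) {i j} → (∀ k l → ¬ Blockedℕ g k l) →
  ∀ k l → Blockedℕ (insertℕ i j g) k l → InsertionBlocks g i j
blocked-insertℕ g unblocked k zero    (() , _)
blocked-insertℕ g unblocked k (suc l) (w , c , e , s) =
  insertion-blocks g unblocked (insertℕ-true g w) (insertℕ-true g c) (insertℕ-true g e) (insertℕ-true g s)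

maximal-insertion-blocks : ∀ {m n} {C : Config m n} → Maximal C →
  ∀ x y → C x y ≡ false → InsertionBlocks (occupied C) (toℕ x) (toℕ y)
maximal-insertion-blocks {m} {n} {C} (P , M) x y Cxy =
  decidable-stable (T? _ ⊎-dec T? _ ⊎-dec T? _ ⊎-dec T? _) λ ¬blocks →
    M D (λ u v b → ¬blocks (blocked-insertℕ g (permissible-occupied P) (toℕ u) (toℕ v)
                                                (blocked-restrict (insertℕ (toℕ x) (toℕ y) g) b)))
      (C⊆D , x , y , Dxy , Cxy)
  where
  g : Grid
  g = occupied C
  D : Config m n
  D = restrict (insertℕ (toℕ x) (toℕ y) g)
  C⊆D : C ⊆ D
  C⊆D u v Cuv rewrite occupied-toℕ C u v | Cuv = refl
  Dxy : D x y ≡ true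
  Dxy = to T-≡ (from T-∨ (inj₂ (from T-∧ (≡⇒≡ᵇ (toℕ x) _ refl , ≡⇒≡ᵇ (toℕ y) _ refl))))

maximal-vacancies-block : ∀ {m n} {C : Config m n} → Maximal C →
  ∀ {i} → i < m → ∀ {j} → j < n → T (not (occupied C i j)) → InsertionBlocks (occupied C) i j
maximal-vacancies-block {m} {n} {C} M = ∀Fin⇒∀< {P = Vacancy-blocks} λ x → ∀Fin⇒∀< λ y vacant →
  maximal-insertion-blocks M x y (trans (sym (occupied-toℕ C x y)) (to T-not-≡ vacant))
  where
  Vacancy-blocks : ℕ → Set
  Vacancy-blocks i = ∀ {j} → j < n → T (not (occupied C i j)) → InsertionBlocks (occupied C) i j

houses-runs : ∀ n (g : Grid) i →
  houses n g i ≡ houses n (runEnd g) i + houses n (runStart g) i + houses n (runInterior g) i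
houses-runs n g i =
  trans (∑-cong n (λ {j} _ → run-split (g i j) (west (g i) j) (g i (suc j)))) (∑-distrib-+³ n _ _ _)
  where
  run-split : ∀ a w e → ⟦ a ⟧ ≡ ⟦ a ∧ not e ⟧ + ⟦ a ∧ not w ∧ e ⟧ + ⟦ a ∧ w ∧ e ⟧
  run-split false w     e     = refl
  run-split true  false false = refl
  run-split true  false true  = refl
  run-split true  true  false = refl
  run-split true  true  true  = refl

northVacant : Grid → ℕ → ℕ → Bool
northVacant g i j = northBlocking g i j ∧ not (g i j)

vacancies-in-row : ∀ n (g : Grid) i → g i n ≡ false →
  (∀ {j} → j < n → T (not (g i j)) → InsertionBlocks g i j) →
  vacancies n g i ≤ houses n (runEnd g) i + houses n (runStart g) i + houses n (northVacant g) i
vacancies-in-row n g i east-border blocks = begin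
  vacancies n g i
    ≤⟨ ∑-mono-≤ n (λ {j} j<n → vacancy-covered (g i j) (selfBlocking g i j) (westBlocking g i j)
                                 (eastBlocking g i j) (northBlocking g i j) (blocks j<n)) ⟩
  ∑[ j < n ] (⟦ (selfBlocking g i j ∨ westBlocking g i j) ∧ not (g i j) ⟧
              + ⟦ eastBlocking g i j ∧ not (g i j) ⟧ + ⟦ northVacant g i j ⟧)
    ≡⟨ ∑-distrib-+³ n _ _ _ ⟩
  ∑[ j < n ] ⟦ (selfBlocking g i j ∨ westBlocking g i j) ∧ not (g i j) ⟧
    + ∑[ j < n ] ⟦ eastBlocking g i j ∧ not (g i j) ⟧ + houses n (northVacant g) i
    ≤⟨ +-monoˡ-≤ (houses n (northVacant g) i) (+-mono-≤ west-neighbours east-neighbours) ⟩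
  houses n (runEnd g) i + houses n (runStart g) i + houses n (northVacant g) i ∎
  where
  open ≤-Reasoning

  vacancy-covered : ∀ o s w e v → (T (not o) → T s ⊎ T w ⊎ T e ⊎ T v) →
    ⟦ not o ⟧ ≤ ⟦ (s ∨ w) ∧ not o ⟧ + ⟦ e ∧ not o ⟧ + ⟦ v ∧ not o ⟧
  vacancy-covered true  s     w     e     v     _ = z≤n
  vacancy-covered false true  w     e     v     _ = s≤s z≤n
  vacancy-covered false false true  e     v     _ = s≤s z≤n
  vacancy-covered false false false true  v     _ = s≤s z≤n
  vacancy-covered false false false false true  _ = ≤-refl
  vacancy-covered false false false false false h with h _
  ... | inj₁ ()
  ... | inj₂ (inj₁ ())
  ... | inj₂ (inj₂ (inj₁ ()))
  ... | inj₂ (inj₂ (inj₂ ()))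

  west-of-vacancy : ∀ a p q o → ⟦ ((a ∧ p) ∨ (a ∧ q)) ∧ not o ⟧ ≤ ⟦ a ∧ not o ⟧
  west-of-vacancy false p q o = z≤n
  west-of-vacancy true  p q o = ⟦∧⟧≤⟦⟧ʳ (p ∨ q) (not o)

  east-of-vacancy : ∀ a b c o → ⟦ (a ∧ b ∧ c) ∧ not o ⟧ ≤ ⟦ a ∧ not o ∧ b ⟧
  east-of-vacancy false b     c     o     = z≤n
  east-of-vacancy true  false c     o     = z≤n
  east-of-vacancy true  true  false o     = z≤n
  east-of-vacancy true  true  true  false = ≤-refl
  east-of-vacancy true  true  true  true  = z≤n

  west-neighbours : ∑[ j < n ] ⟦ (selfBlocking g i j ∨ westBlocking g i j) ∧ not (g i j) ⟧
                    ≤ houses n (runEnd g) i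
  west-neighbours = begin
    ∑[ j < n ] ⟦ (selfBlocking g i j ∨ westBlocking g i j) ∧ not (g i j) ⟧
      ≤⟨ ∑-≤-∑∘suc n _ ⟩
    ∑[ j < n ] ⟦ (selfBlocking g i (suc j) ∨ westBlocking g i (suc j)) ∧ not (g i (suc j)) ⟧ + 0
      ≡⟨ +-identityʳ _ ⟩
    ∑[ j < n ] ⟦ (selfBlocking g i (suc j) ∨ westBlocking g i (suc j)) ∧ not (g i (suc j)) ⟧
      ≤⟨ ∑-mono-≤ n (λ {j} _ → west-of-vacancy (g i j) _ _ (g i (suc j))) ⟩
    houses n (runEnd g) i ∎

  east-neighbours : ∑[ j < n ] ⟦ eastBlocking g i j ∧ not (g i j) ⟧ ≤ houses n (runStart g) i
  east-neighbours = begin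
    ∑[ j < n ] ⟦ eastBlocking g i j ∧ not (g i j) ⟧
      ≤⟨ ∑-mono-≤ n (λ {j} _ → east-of-vacancy (g i (suc j)) (g i (suc (suc j))) (g (suc i) (suc j)) (g i j)) ⟩
    ∑[ j < n ] ⟦ runStart g i (suc j) ⟧
      ≤⟨ ∑∘suc-≤-∑ n (λ j → ⟦ runStart g i j ⟧) ⟩
    houses n (runStart g) i + ⟦ runStart g i n ⟧
      ≡⟨ cong (λ x → houses n (runStart g) i + ⟦ x ∧ not (west (g i) n) ∧ g i (suc n) ⟧) east-border ⟩
    houses n (runStart g) i + 0
      ≡⟨ +-identityʳ _ ⟩
    houses n (runStart g) i ∎

∑northVacant≤∑runInterior : ∀ m n (g : Grid) →
  ∑ m (houses n (northVacant g)) ≤ ∑ m (houses n (runInterior g))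
∑northVacant≤∑runInterior m n g = begin
  ∑ m northern                  ≤⟨ ∑-≤-∑∘suc m northern ⟩
  ∑ m (northern ∘ suc) + ∑[ j < n ] 0
    ≡⟨ cong (∑ m (northern ∘ suc) +_) (trans (∑-const n 0) (*-zeroʳ n)) ⟩
  ∑ m (northern ∘ suc) + 0      ≡⟨ +-identityʳ _ ⟩
  ∑ m (northern ∘ suc)
    ≤⟨ ∑-mono-≤ m (λ {i} _ → ∑-mono-≤ n (λ {j} _ → ⟦∧⟧≤⟦⟧ˡ (runInterior g i j) (not (g (suc i) j)))) ⟩
  ∑ m (houses n (runInterior g)) ∎
  where
  open ≤-Reasoning
  northern : ℕ → ℕ
  northern = houses n (northVacant g)

vacancies≤houses : ∀ m n (g : Grid) → (∀ i → g i n ≡ false) →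
  (∀ {i} → i < m → ∀ {j} → j < n → T (not (g i j)) → InsertionBlocks g i j) →
  ∑ m (vacancies n g) ≤ ∑ m (houses n g)
vacancies≤houses m n g east-border blocks = begin
  ∑ m (vacancies n g)                           ≤⟨ ∑-mono-≤ m (λ {i} i<m → vacancies-in-row n g i (east-border i) (blocks i<m)) ⟩
  ∑[ i < m ] (ends i + starts i + northern i)   ≡⟨ ∑-distrib-+³ m ends starts northern ⟩
  ∑ m ends + ∑ m starts + ∑ m northern          ≤⟨ +-monoʳ-≤ (∑ m ends + ∑ m starts) (∑northVacant≤∑runInterior m n g) ⟩
  ∑ m ends + ∑ m starts + ∑ m interiors         ≡⟨ ∑-distrib-+³ m ends starts interiors ⟨
  ∑[ i < m ] (ends i + starts i + interiors i)  ≡⟨ ∑-cong m (λ {i} _ → houses-runs n g i) ⟨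
  ∑ m (houses n g)                              ∎
  where
  open ≤-Reasoning
  ends starts interiors northern : ℕ → ℕ
  ends      = houses n (runEnd g)
  starts    = houses n (runStart g)
  interiors = houses n (runInterior g)
  northern  = houses n (northVacant g)

lemma2p1 : ∀ (m n : ℕ) → 2 ≤ m → 2 ≤ n → (C : Config m n) → Maximal C →
    (m * n ≤ 2 * card C) × (4 * card C ≤ 3 * (m * n) + 2 * (m ∸ 1) + n)
lemma2p1 zero     n ()  _ C M
lemma2p1 (suc m′) n _ _ C M@(P , _) rewrite card-occupied C = lower , upper
  where
  open ≤-Reasoning
  m : ℕ
  m = suc m′
  g : Grid
  g = occupied C

  lower : m * n ≤ 2 * ∑ m (houses n g)
  lower = begin
    m * n                                   ≡⟨ ∑vacancies+∑houses m n g ⟨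
    ∑ m (vacancies n g) + ∑ m (houses n g)  ≤⟨ +-monoˡ-≤ _ (vacancies≤houses m n g (λ i → occupied-≥ C i ≤-refl)
                                                              (maximal-vacancies-block M)) ⟩
    ∑ m (houses n g) + ∑ m (houses n g)     ≡⟨ cong (∑ m (houses n g) +_) (+-identityʳ _) ⟨
    2 * ∑ m (houses n g)                    ∎

  upper : 4 * ∑ m (houses n g) ≤ 3 * (m * n) + 2 * m′ + n
  upper = begin
    4 * ∑ m (houses n g)
      ≤⟨ 4*∑-≤ m′ (houses n g) (houses≤n n g)
           (λ i → adjacent-rows n g i (occupied-≥ C i ≤-refl) (permissible-occupied P i)) ⟩
    m′ * (3 * n + 2) + 4 * n  ≡⟨ rearrange m′ n ⟩
    3 * (m * n) + 2 * m′ + n  ∎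
    where
    rearrange : ∀ m′ n → m′ * (3 * n + 2) + 4 * n ≡ 3 * (suc m′ * n) + 2 * m′ + n
    rearrange = solve-∀
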